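{- Let $G$ be a 3-connected graph. Let $\sigma$ be a star of oriented separations of $G$ of order $3$ such that the bag $X$ of $\sigma$ has exactly four vertices. Then the following are equivalent: (i) $\sigma$ is included in some 4-tangle in $G$; (ii) $X$ is cubic in $G$; (iii) $X$ is cubic in $G$, and for every standard cube-minor $\varphi\colon G\succcurlyeq Q$ at $X$, the $\varphi$-lift to $G$ of the unique 4-tangle in the cube $Q$ includes $\sigma$.
   Context: All graphs are finite and simple. A separation of $G$ is a set $\{A,B\}$ with $A\cup B=V(G)$ and no edge between $A\setminus B$ and $B\setminus A$; its order is $|A\cap B|$; its orientations are $(A,B)$ and $(B,A)$. Write $(A,B)\le(C,D)$ if $A\subseteq C$ and $B\supseteq D$. A set $\sigma=\{(A_i,B_i):i\in I\}$ of oriented separations is a star if $(A_i,B_i)\le(B_j,A_j)$ for all $i\ne j$; its bag is $\bigcap_{i\in I}B_i$ (equal to $V(G)$ if $I=\emptyset$). A $k$-tangle in $G$ is a set $\tau$ of oriented separations of order $<k$ that contains exactly one orientation of every separation of order $<k$, and contains no three (not necessarily distinct) elements $(A_1,B_1),(A_2,B_2),(A_3,B_3)$ with $G[A_1]\cup G[A_2]\cup G[A_3]=G$. A minor-map $\varphi\colon G\succcurlyeq H$ is a pair $(U,f)$, $U\subseteq V(G)$, $f\colon U\to V(H)$ surjective, such that the branch sets $f^{ -1}(x)$ induce connected subgraphs and for each edge $xy$ of $H$ some edge of $G$ joins $f^{ -1}(x)$ and $f^{ -1}(y)$. For an oriented separation $(A,B)$ of $G$, $\varphi(A,B):=(A_\varphi,B_\varphi)$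 where $A_\varphi$ is the set of vertices of $H$ whose branch set meets $A$, similarly $B_\varphi$. For a $k$-tangle $\tau$ of $H$, its $\varphi$-lift is the set of oriented separations $s$ of $G$ of order $<k$ with $\varphi(s)\in\tau$. The cube $Q$ is the graph of the 3-dimensional cube; it has exactly one 4-tangle. A set $X$ of four vertices of $G$ is cubic in $G$ if the set of neighbourhoods of the components of $G-X$ equals the set of all 3-element subsets of $X$. If $X$ is cubic, a standard cube-minor at $X$ is a minor-map $\varphi\colon G\succcurlyeq Q$ obtained as follows: view $Q$ as bipartite with classes $\{b_x:x\in X\}$ and $\{a_x:x\in X\}$, where $a_x$ is adjacent to $b_y$ exactly when $y\ne x$; set $\varphi^{ -1}(b_x)=\{x\}$ and $\varphi^{ -1}(a_x)=V(C_x)$ for a chosen component $C_x$ of $G-X$ whose neighbourhood is $X\setminus\{x\}$. -}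

module Defs where

open import Data.Nat using (ℕ; zero; suc; _<_)
open import Data.Bool using (Bool; true; false; _∧_; _∨_; not)
open import Data.Fin using (Fin; zero; suc; splitAt; _↑ˡ_; _↑ʳ_)
open import Data.Fin.Subset using (Subset; _∈_; _∉_; _⊆_; _∩_; ∁; ∣_∣; _-_)
open import Data.Vec using (tabulate; lookup)
open import Data.Maybe using (Maybe; just; nothing)
open import Data.Product using (Σ; ∃; _×_; _,_)
open import Data.Sum using (_⊎_; inj₁; inj₂)
open import Data.Empty using (⊥)
open import Relation.Nullary using (¬_; does)
open import Relation.Binary.PropositionalEquality using (_≡_; _≢_)
import Data.Fin as F

record Graph : Set where
  constructor mkGraph
  field
    n   : ℕ
    adj : Fin n → Fin n → Bool
open Graph public

Simple : Graph → Set
Simple G = (∀ x y → adj G x y ≡ adj G y x) × (∀ x → adj G x x ≡ false)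

Edge : (G : Graph) → Fin (n G) → Fin (n G) → Set
Edge G x y = adj G x y ≡ true

VSet : Graph → Set
VSet G = Subset (n G)

data Reach (G : Graph) (U : VSet G) (x : Fin (n G)) : Fin (n G) → Set where
  here : x ∈ U → Reach G U x x
  step : ∀ {y z} → Reach G U x y → z ∈ U → Edge G y z → Reach G U x z

Connected : (G : Graph) → VSet G → Set
Connected G U = ∀ x y → x ∈ U → y ∈ U → Reach G U x y

ThreeConnected : Graph → Set
ThreeConnected G = (3 < n G) × (∀ (S : VSet G) → ∣ S ∣ < 3 → Connected G (∁ S))

IsSep : (G : Graph) → VSet G → VSet G → Set
IsSep G A B =
  (∀ x → x ∈ A ⊎ x ∈ B) ×
  (∀ x y → x ∈ A → x ∉ B → y ∈ B → y ∉ A → ¬ Edge G x y)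

order : (G : Graph) → VSet G → VSet G → ℕ
order G A B = ∣ A ∩ B ∣

SepSet : Graph → Set₁
SepSet G = VSet G → VSet G → Set

-- σ is a star of oriented separations:
-- (A,B) ≤ (D,C) for distinct (A,B), (C,D) in σ, i.e. A ⊆ D and B ⊇ C
Star : (G : Graph) → SepSet G → Set
Star G σ =
  (∀ A B → σ A B → IsSep G A B) ×
  (∀ A B C D → σ A B → σ C D → (A , B) ≢ (C , D) → (A ⊆ D) × (C ⊆ B))

IsBag : (G : Graph) → SepSet G → VSet G → Set
IsBag G σ X = ∀ x → (x ∈ X → ∀ A B → σ A B → x ∈ B) × ((∀ A B → σ A B → x ∈ B) → x ∈ X)

Covers : (G : Graph) → VSet G → VSet G → VSet G → Set
Covers G A₁ A₂ A₃ =
  (∀ x → x ∈ A₁ ⊎ x ∈ A₂ ⊎ x ∈ A₃) ×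
  (∀ x y → Edge G x y → (x ∈ A₁ × y ∈ A₁) ⊎ (x ∈ A₂ × y ∈ A₂) ⊎ (x ∈ A₃ × y ∈ A₃))

Tangle : (G : Graph) → ℕ → SepSet G → Set
Tangle G k τ =
  (∀ A B → τ A B → IsSep G A B × order G A B < k) ×
  (∀ A B → IsSep G A B → order G A B < k → τ A B ⊎ τ B A) ×
  -- at most one orientation (the two orientations (A,B),(B,A) coincide iff A ≡ B)
  (∀ A B → τ A B → τ B A → A ≡ B) ×
  (∀ A₁ B₁ A₂ B₂ A₃ B₃ → τ A₁ B₁ → τ A₂ B₂ → τ A₃ B₃ → ¬ Covers G A₁ A₂ A₃)

Component : (G : Graph) → VSet G → VSet G → Set
Component G X C =
  (∃ λ x → x ∈ C) ×
  (∀ x → x ∈ C → x ∉ X) ×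
  Connected G C ×
  (∀ x y → x ∈ C → y ∉ X → Edge G x y → y ∈ C)

IsNbhd : (G : Graph) → VSet G → VSet G → Set
IsNbhd G C Y = ∀ y →
  (y ∈ Y → y ∉ C × ∃ λ x → x ∈ C × Edge G x y) ×
  ((y ∉ C × ∃ λ x → x ∈ C × Edge G x y) → y ∈ Y)

Cubic : (G : Graph) → VSet G → Set
Cubic G X =
  (∣ X ∣ ≡ 4) ×
  (∀ C Y → Component G X C → IsNbhd G C Y → Y ⊆ X × ∣ Y ∣ ≡ 3) ×
  (∀ Y → Y ⊆ X → ∣ Y ∣ ≡ 3 → ∃ λ C → Component G X C × IsNbhd G C Y)

-- The cube Q on Fin 8 = Fin (4 + 4):
-- b i = i ↑ˡ 4 (one class), a i = 4 ↑ʳ i (other class), a i ~ b j iff i ≠ j.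

bQ : Fin 4 → Fin 8
bQ i = i ↑ˡ 4

aQ : Fin 4 → Fin 8
aQ i = 4 ↑ʳ i

private
  neq : Fin 4 → Fin 4 → Bool
  neq i j = not (does (i F.≟ j))

QAdj : Fin 8 → Fin 8 → Bool
QAdj u v with splitAt 4 u | splitAt 4 v
... | inj₁ i | inj₂ j = neq i j
... | inj₂ i | inj₁ j = neq i j
... | inj₁ _ | inj₁ _ = false
... | inj₂ _ | inj₂ _ = false

Q : Graph
Q = mkGraph 8 QAdj

-- Minor maps φ = (U , f) encoded as f : V(G) → Maybe V(H), U = {v | f v ≠ nothing}.

anyFin : ∀ {m} → (Fin m → Bool) → Bool
anyFin {zero}  p = false
anyFin {suc m} p = p zero ∨ anyFin (λ i → p (suc i))

hitsAt : ∀ {m} → Maybe (Fin m) → Fin m → Bool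
hitsAt nothing  h = false
hitsAt (just y) h = does (y F.≟ h)

image : ∀ {k m} → (Fin k → Maybe (Fin m)) → Subset k → Subset m
image f A = tabulate λ h → anyFin λ v → lookup A v ∧ hitsAt (f v) h

-- f is (the map of) a standard cube-minor φ : G ≽ Q at X,
-- where x ↦ b_x is given by the bijection e : Fin 4 → X and C i is the chosen
-- component with neighbourhood X ∖ {e i}.
StdCubeMinor : (G : Graph) → VSet G → (Fin (n G) → Maybe (Fin 8)) → Set
StdCubeMinor G X f =
  Σ (Fin 4 → Fin (n G)) λ e →
  Σ (Fin 4 → VSet G) λ C →
    (∀ i j → e i ≡ e j → i ≡ j) ×
    (∀ x → (x ∈ X → ∃ λ i → e i ≡ x) × ((∃ λ i → e i ≡ x) → x ∈ X)) ×
    (∀ i → Component G X (C i) × IsNbhd G (C i) (X - e i)) ×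
    (∀ i → f (e i) ≡ just (bQ i)) ×
    (∀ i v → v ∈ C i → f v ≡ just (aQ i)) ×
    (∀ v → (∀ i → e i ≢ v) → (∀ i → v ∉ C i) → f v ≡ nothing)

LiftIncludes : (G : Graph) → (Fin (n G) → Maybe (Fin 8)) → ℕ → SepSet Q → SepSet G → Set
LiftIncludes G f k τ σ = ∀ A B → σ A B → order G A B < k × τ (image f A) (image f B)

-- (i) ⇒ (ii): by 3-connectivity a component C of G − X has at least three neighbours, and at most three
-- because C lies on the private side of some separation in σ, whose separator then contains N(C).
-- If some X − x were not of the form N(C), every component would be adjacent to x and miss another vertex
-- of X. For each x′ ∈ X − x the tangle contains ((X − x′) ∪ T, V ∖ T), where T is the union of the
-- components not adjacent to x′: for a single component since σ ⊆ τ, and then for unions by the tangle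
-- axiom. The small sides of these three separations cover G.
-- (ii) ⇒ (iii): the separator of a separation in σ misses some e_i ∈ X, so under a standard cube-minor the
-- image of its big side contains every vertex of the cube but a_i, which no small side of a 4-tangle does.
-- (iii) ⇒ (i): the separations of the cube of order at most 3 whose small side has at most one private
-- vertex form a 4-tangle; its lift along a standard cube-minor, which exists as X is cubic, contains σ.

module Submission where

open import Defs
open import Data.Nat using (ℕ; zero; suc; _+_; _≤_; _<_; _≤?_; z≤n; s≤s)
open import Data.Nat.Properties
  using (≤-trans; ≤-reflexive; ≤-antisym; ≤-pred; ≤-<-trans; <⇒≱; ≮⇒≥; ≰⇒>; n<1+n; +-suc; +-mono-≤; suc-injective)
open import Data.Bool using (Bool; true; false; _∧_) renaming (_≟_ to _≟ᵇ_)
open import Data.Empty using (⊥; ⊥-elim)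
open import Data.Fin using (Fin; zero; suc; punchIn; punchOut)
open import Data.Fin.Properties using (any?; all?; ¬∀⟶∃¬; punchIn-punchOut; ↑ˡ-injective; ↑ʳ-injective)
  renaming (_≟_ to _≟ᶠ_; suc-injective to Fin-suc-injective)
open import Data.Fin.Subset
  using (Subset; _∈_; _∉_; _⊆_; _⊈_; _∩_; _∪_; _─_; _-_; ∁; ∣_∣; ⁅_⁆; ⋃; ⊤; inside; outside) renaming (⊥ to ∅)
open import Data.Fin.Subset.Properties
  using (_∈?_; _⊆?_; p⊆q⇒∣p∣≤∣q∣; p⊂q⇒∣p∣<∣q∣; ∣p∣≤n; ∣p∩q∣≤∣p∣; x∈p⇒∣p-x∣<∣p∣; p─⊥≡p; p─q⊆p;
         x∈⁅x⁆; x∈⁅y⁆⇒x≡y; x≢y⇒x∉⁅y⁆; x∉⁅y⁆⇒x≢y; x∈p∩q⁺; x∈p∩q⁻; x∈p∪q⁺; x∈p∪q⁻;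
         x∈∁p⇒x∉p; x∉p⇒x∈∁p; x∉∁p⇒x∈p; x∈p∧x≢y⇒x∈p-y; x∈p∧x∉q⇒x∈p─q; drop-there; ∈⊤; ∩-comm; ⊆-antisym)
  renaming (∉⊥ to ∉∅)
import Data.List as List
open import Data.Maybe using (Maybe; just; nothing)
open import Data.Maybe.Properties using (just-injective)
open import Data.Product using (Σ; ∃; ∃₂; _×_; _,_; proj₁; proj₂)
import Data.Product as Product
open import Data.Sum using (_⊎_; inj₁; inj₂)
import Data.Sum as Sum
open import Data.Vec using (_∷_; []; lookup; tabulate; here; there)
open import Data.Vec.Properties using (lookup∘tabulate; lookup⇒[]=; []=⇒lookup; ≡-dec)
open import Function using (_∘_)
open import Relation.Binary.PropositionalEquality using (_≡_; _≢_; refl; sym; trans; cong; subst)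
open import Relation.Nullary using (Dec; yes; no; does; ¬_; ¬?; _×-dec_; _⊎-dec_; _→-dec_; contradiction)
open import Relation.Nullary.Decidable using (dec-true; decidable-stable; from-yes; map′)
open import Relation.Unary using (Pred; Decidable)

∈-tabulate⁺ : ∀ {k} {g : Fin k → Bool} {x} → g x ≡ true → x ∈ tabulate g
∈-tabulate⁺ {g = g} {x} gx = lookup⇒[]= x (tabulate g) (trans (lookup∘tabulate g x) gx)

∈-tabulate⁻ : ∀ {k} {g : Fin k → Bool} {x} → x ∈ tabulate g → g x ≡ true
∈-tabulate⁻ {g = g} {x} x∈ = trans (sym (lookup∘tabulate g x)) ([]=⇒lookup x∈)

select : ∀ {k ℓ} {P : Pred (Fin k) ℓ} → Decidable P → Subset k
select P? = tabulate (does ∘ P?)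

module _ {k ℓ} {P : Pred (Fin k) ℓ} (P? : Decidable P) {x : Fin k} where

  ∈-select⁺ : P x → x ∈ select P?
  ∈-select⁺ px = ∈-tabulate⁺ (dec-true (P? x) px)

  ∈-select⁻ : x ∈ select P? → P x
  ∈-select⁻ x∈ with P? x | ∈-tabulate⁻ {g = does ∘ P?} x∈
  ... | yes px | _ = px

anyFin⁺ : ∀ {k} (p : Fin k → Bool) i → p i ≡ true → anyFin p ≡ true
anyFin⁺ p zero pi rewrite pi = refl
anyFin⁺ p (suc i) pi with p zero
... | true  = refl
... | false = anyFin⁺ (p ∘ suc) i pi

anyFin⁻ : ∀ {k} (p : Fin k → Bool) → anyFin p ≡ true → ∃ λ i → p i ≡ true
anyFin⁻ {suc k} p any with p zero in p₀
... | true  = zero , p₀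
... | false with anyFin⁻ (p ∘ suc) any
...   | i , pi = suc i , pi

module _ {k m} {f : Fin k → Maybe (Fin m)} {A : Subset k} where

  ∈-image⁺ : ∀ {v h} → v ∈ A → f v ≡ just h → h ∈ image f A
  ∈-image⁺ {v} {h} v∈A fv = ∈-tabulate⁺ (anyFin⁺ _ v hit)
    where
    hit : lookup A v ∧ hitsAt (f v) h ≡ true
    hit rewrite []=⇒lookup v∈A | fv with h ≟ᶠ h
    ... | yes _ = refl
    ... | no h≢h = contradiction refl h≢h

  ∈-image⁻ : ∀ {h} → h ∈ image f A → ∃ λ v → v ∈ A × f v ≡ just h
  ∈-image⁻ {h} h∈ with anyFin⁻ _ (∈-tabulate⁻ h∈)
  ... | v , hit with lookup A v in Av | f v in fv
  ...   | true | just y with y ≟ᶠ h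
  ...     | yes refl = v , lookup⇒[]= v A Av , fv

⊈⇒∃∉ : ∀ {k} {p q : Subset k} → p ⊈ q → ∃ λ x → x ∈ p × x ∉ q
⊈⇒∃∉ {k} {p} {q} p⊈q with ¬∀⟶∃¬ k _ (λ x → x ∈? p →-dec x ∈? q) (λ p⊆q → p⊈q (p⊆q _))
... | x , ¬x∈p⇒x∈q with x ∈? p
...   | yes x∈p = x , x∈p , λ x∈q → ¬x∈p⇒x∈q (λ _ → x∈q)
...   | no  x∉p = contradiction (λ x∈p → contradiction x∈p x∉p) ¬x∈p⇒x∈q

⊆∧∣q∣≤∣p∣⇒q⊆p : ∀ {k} {p q : Subset k} → p ⊆ q → ∣ q ∣ ≤ ∣ p ∣ → q ⊆ p
⊆∧∣q∣≤∣p∣⇒q⊆p {p = p} {q} p⊆q ∣q∣≤∣p∣ with q ⊆? p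
... | yes q⊆p = q⊆p
... | no  q⊈p = contradiction ∣q∣≤∣p∣ (<⇒≱ (p⊂q⇒∣p∣<∣q∣ (p⊆q , ⊈⇒∃∉ q⊈p)))

∣p∣≡1+∣p-x∣ : ∀ {k} {x : Fin k} {p : Subset k} → x ∈ p → ∣ p ∣ ≡ suc ∣ p - x ∣
∣p∣≡1+∣p-x∣ {p = inside ∷ p} here = cong (suc ∘ ∣_∣) (sym (p─⊥≡p p))
∣p∣≡1+∣p-x∣ {p = inside ∷ p} (there x∈p) = cong suc (∣p∣≡1+∣p-x∣ x∈p)
∣p∣≡1+∣p-x∣ {p = outside ∷ p} (there x∈p) = ∣p∣≡1+∣p-x∣ x∈p

∣p∣≤∣q∣-by-injection : ∀ {m k} (p : Subset m) (q : Subset k) (g : ∀ x → x ∈ p → Fin k) →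
  (∀ x x∈p → g x x∈p ∈ q) → (∀ x y x∈p y∈p → g x x∈p ≡ g y y∈p → x ≡ y) → ∣ p ∣ ≤ ∣ q ∣
∣p∣≤∣q∣-by-injection [] q g g∈q g-inj = z≤n
∣p∣≤∣q∣-by-injection (outside ∷ p) q g g∈q g-inj =
  ∣p∣≤∣q∣-by-injection p q (λ x → g (suc x) ∘ there) (λ x → g∈q (suc x) ∘ there)
    (λ x y x∈p y∈p → Fin-suc-injective ∘ g-inj (suc x) (suc y) (there x∈p) (there y∈p))
∣p∣≤∣q∣-by-injection (inside ∷ p) q g g∈q g-inj =
  ≤-trans (s≤s (∣p∣≤∣q∣-by-injection p (q - g zero here) (λ x → g (suc x) ∘ there)
                  (λ x x∈p → x∈p∧x≢y⇒x∈p-y (g∈q (suc x) (there x∈p)) (g-suc≢g-zero x∈p))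
                  (λ x y x∈p y∈p → Fin-suc-injective ∘ g-inj (suc x) (suc y) (there x∈p) (there y∈p))))
          (x∈p⇒∣p-x∣<∣p∣ (g∈q zero here))
  where
  g-suc≢g-zero : ∀ {x} (x∈p : x ∈ p) → g (suc x) (there x∈p) ≢ g zero here
  g-suc≢g-zero x∈p eq with g-inj _ _ (there x∈p) here eq
  ... | ()

record Enumeration {k} (p : Subset k) (m : ℕ) : Set where
  field
    at            : Fin m → Fin k
    at-injective  : ∀ i j → at i ≡ at j → i ≡ j
    at-∈          : ∀ i → at i ∈ p
    at-surjective : ∀ {x} → x ∈ p → ∃ λ i → at i ≡ x

enumeration : ∀ {k} (p : Subset k) → Enumeration p ∣ p ∣
enumeration [] = record
  { at = λ () ; at-injective = λ () ; at-∈ = λ () ; at-surjective = λ () }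
enumeration (outside ∷ p) = record
  { at            = suc ∘ at
  ; at-injective  = λ i j → at-injective i j ∘ Fin-suc-injective
  ; at-∈          = there ∘ at-∈
  ; at-surjective = λ { (there x∈p) → let i , eq = at-surjective x∈p in i , cong suc eq }
  }
  where open Enumeration (enumeration p)
enumeration (inside ∷ p) = record
  { at            = λ { zero → zero ; (suc i) → suc (at i) }
  ; at-injective  = λ { zero zero _ → refl ; (suc i) (suc j) eq → cong suc (at-injective i j (Fin-suc-injective eq)) }
  ; at-∈          = λ { zero → here ; (suc i) → there (at-∈ i) }
  ; at-surjective = λ { here → zero , refl
                      ; (there x∈p) → let i , eq = at-surjective x∈p in suc i , cong suc eq }
  }
  where open Enumeration (enumeration p)

∈⋃-tabulate⁺ : ∀ {k m} (S : Fin m → Subset k) u {x} → x ∈ S u → x ∈ ⋃ (List.tabulate S)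
∈⋃-tabulate⁺ S zero    x∈ = x∈p∪q⁺ (inj₁ x∈)
∈⋃-tabulate⁺ S (suc u) x∈ = x∈p∪q⁺ (inj₂ (∈⋃-tabulate⁺ (S ∘ suc) u x∈))

∈⋃-tabulate⁻ : ∀ {k m} (S : Fin m → Subset k) {x} → x ∈ ⋃ (List.tabulate S) → ∃ λ u → x ∈ S u
∈⋃-tabulate⁻ {m = zero}  S x∈ = contradiction x∈ ∉∅
∈⋃-tabulate⁻ {m = suc m} S x∈ with x∈p∪q⁻ (S zero) _ x∈
... | inj₁ x∈S₀ = zero , x∈S₀
... | inj₂ x∈⋃ = let u , x∈Su = ∈⋃-tabulate⁻ (S ∘ suc) x∈⋃ in suc u , x∈Su

_≟ˢ_ : ∀ {k} (p q : Subset k) → Dec (p ≡ q)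
_≟ˢ_ = ≡-dec _≟ᵇ_

∣p∣≡∣p─q∣+∣p∩q∣ : ∀ {k} (p q : Subset k) → ∣ p ∣ ≡ ∣ p ─ q ∣ + ∣ p ∩ q ∣
∣p∣≡∣p─q∣+∣p∩q∣ [] [] = refl
∣p∣≡∣p─q∣+∣p∩q∣ (inside  ∷ p) (inside  ∷ q) = trans (cong suc (∣p∣≡∣p─q∣+∣p∩q∣ p q)) (sym (+-suc _ _))
∣p∣≡∣p─q∣+∣p∩q∣ (inside  ∷ p) (outside ∷ q) = cong suc (∣p∣≡∣p─q∣+∣p∩q∣ p q)
∣p∣≡∣p─q∣+∣p∩q∣ (outside ∷ p) (inside  ∷ q) = ∣p∣≡∣p─q∣+∣p∩q∣ p q
∣p∣≡∣p─q∣+∣p∩q∣ (outside ∷ p) (outside ∷ q) = ∣p∣≡∣p─q∣+∣p∩q∣ p q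

x∈p─q⁻ : ∀ {k} {x : Fin k} (p q : Subset k) → x ∈ p ─ q → x ∈ p × x ∉ q
x∈p─q⁻ {x = zero} (inside  ∷ p) (outside ∷ q) here = here , λ ()
x∈p─q⁻ {x = zero} (outside ∷ p) (outside ∷ q) ()
x∈p─q⁻ {x = zero} (outside ∷ p) (inside  ∷ q) ()
x∈p─q⁻ {x = suc _} (_ ∷ p) (_ ∷ q) (there x∈) = let x∈p , x∉q = x∈p─q⁻ p q x∈ in there x∈p , x∉q ∘ drop-there

allSubset? : ∀ {k ℓ} {P : Pred (Subset k) ℓ} → Decidable P → Dec (∀ p → P p)
allSubset? {zero}  P? = map′ (λ { P[] [] → P[] }) (λ ∀P → ∀P []) (P? [])
allSubset? {suc k} P? = map′ (λ { (∀Pin , ∀Pout) (inside ∷ p) → ∀Pin p ; (∀Pin , ∀Pout) (outside ∷ p) → ∀Pout p })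
  (λ ∀P → (λ p → ∀P (inside ∷ p)) , (λ p → ∀P (outside ∷ p)))
  (allSubset? (λ p → P? (inside ∷ p)) ×-dec allSubset? (λ p → P? (outside ∷ p)))

Both : ∀ {k} → Subset k → Fin k → Fin k → Set
Both S x y = x ∈ S × y ∈ S

∃-Fin4-avoiding : ∀ (i j l : Fin 4) → ∃ λ m → m ≢ i × m ≢ j × m ≢ l
∃-Fin4-avoiding = from-yes (all? {n = 4} λ i → all? λ j → all? λ l → any? λ m →
  ¬? (m ≟ᶠ i) ×-dec ¬? (m ≟ᶠ j) ×-dec ¬? (m ≟ᶠ l))

one-of-three-others : ∀ {ℓ} (P : Fin 4 → Set ℓ) (i : Fin 4) {j} → j ≢ i → P j →
  P (punchIn i zero) ⊎ P (punchIn i (suc zero)) ⊎ P (punchIn i (suc (suc zero)))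
one-of-three-others P i j≢i Pj with punchOut (j≢i ∘ sym) | punchIn-punchOut (j≢i ∘ sym)
... | zero                | refl = inj₁ Pj
... | suc zero            | refl = inj₂ (inj₁ Pj)
... | suc (suc zero)      | refl = inj₂ (inj₂ Pj)

Edge? : (G : Graph) → ∀ x y → Dec (Edge G x y)
Edge? G x y = adj G x y ≟ᵇ true

module GraphFacts {G : Graph} (simple : Simple G) where

  Edge-sym : ∀ {x y} → Edge G x y → Edge G y x
  Edge-sym {x} {y} = trans (proj₁ simple y x)

  module _ {A B : VSet G} (sep : IsSep G A B) where

    IsSep-swap : IsSep G B A
    IsSep-swap = (λ x → Sum.swap (proj₁ sep x)) , λ x y x∈B x∉A y∈A y∉B → proj₂ sep y x y∈A y∉B x∈B x∉A ∘ Edge-sym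

    ∉ʳ⇒∈ˡ : ∀ {x} → x ∉ B → x ∈ A
    ∉ʳ⇒∈ˡ {x} x∉B = Sum.[ (λ x∈A → x∈A) , (λ x∈B → contradiction x∈B x∉B) ] (proj₁ sep x)

    Edge-from-private-side : ∀ {x y} → x ∉ B → Edge G x y → y ∈ A
    Edge-from-private-side {x} {y} x∉B xy with y ∈? A | y ∈? B
    ... | yes y∈A | _ = y∈A
    ... | no y∉A | yes y∈B = contradiction xy (proj₂ sep x y (∉ʳ⇒∈ˡ x∉B) x∉B y∈B y∉A)
    ... | no y∉A | no y∉B = contradiction (∉ʳ⇒∈ˡ y∉B) y∉A

    Edge-inside-side : ∀ {x y} → Edge G x y → (x ∈ A × y ∈ A) ⊎ (x ∈ B × y ∈ B)
    Edge-inside-side {x} {y} xy with x ∈? B | y ∈? B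
    ... | no x∉B | _ = inj₁ (∉ʳ⇒∈ˡ x∉B , Edge-from-private-side x∉B xy)
    ... | yes _ | no y∉B = inj₁ (Edge-from-private-side y∉B (Edge-sym xy) , ∉ʳ⇒∈ˡ y∉B)
    ... | yes x∈B | yes y∈B = inj₂ (x∈B , y∈B)

    Reach-leaves-through-separator : ∀ {U c z} → Reach G U c z → c ∉ B →
      (∃ λ w → w ∈ U × w ∈ A × w ∈ B) ⊎ z ∉ B
    Reach-leaves-through-separator (here _) c∉B = inj₂ c∉B
    Reach-leaves-through-separator (step {y} {z} path z∈U yz) c∉B
      with Reach-leaves-through-separator path c∉B
    ... | inj₁ w = inj₁ w
    ... | inj₂ y∉B with z ∈? B
    ...   | no z∉B = inj₂ z∉B
    ...   | yes z∈B = inj₁ (z , z∈U , Edge-from-private-side y∉B yz , z∈B)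

  Reach-trans : ∀ {U x y z} → Reach G U x y → Reach G U y z → Reach G U x z
  Reach-trans p (here _) = p
  Reach-trans p (step q z∈U yz) = step (Reach-trans p q) z∈U yz

  Reach-end : ∀ {U x y} → Reach G U x y → y ∈ U
  Reach-end (here y∈U) = y∈U
  Reach-end (step _ y∈U _) = y∈U

  Reach-sym : ∀ {U x y} → Reach G U x y → Reach G U y x
  Reach-sym (here x∈U) = here x∈U
  Reach-sym (step p z∈U yz) = Reach-trans (step (here z∈U) (Reach-end p) (Edge-sym yz)) (Reach-sym p)

  module _ {U K : VSet G} (closed : ∀ y z → y ∈ K → z ∈ U → Edge G y z → z ∈ K) where

    Reach-stays : ∀ {x z} → x ∈ K → Reach G U x z → z ∈ K
    Reach-stays x∈K (here _) = x∈K
    Reach-stays x∈K (step p z∈U yz) = closed _ _ (Reach-stays x∈K p) z∈U yz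

    Reach-restrict : ∀ {x z} → x ∈ K → Reach G U x z → Reach G K x z
    Reach-restrict x∈K (here _) = here x∈K
    Reach-restrict x∈K (step p z∈U yz) = step (Reach-restrict x∈K p) (Reach-stays x∈K (step p z∈U yz)) yz

Neighbour : (G : Graph) → VSet G → Fin (n G) → Set
Neighbour G C y = y ∉ C × ∃ λ x → x ∈ C × Edge G x y

neighbour? : (G : Graph) (C : VSet G) → ∀ y → Dec (Neighbour G C y)
neighbour? G C y = ¬? (y ∈? C) ×-dec any? λ x → x ∈? C ×-dec Edge? G x y

nbhd : (G : Graph) → VSet G → VSet G
nbhd G C = select (neighbour? G C)

nbhd-IsNbhd : (G : Graph) (C : VSet G) → IsNbhd G C (nbhd G C)
nbhd-IsNbhd G C y = ∈-select⁻ (neighbour? G C) , ∈-select⁺ (neighbour? G C)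

module Reachability {G : Graph} (simple : Simple G) (U : VSet G) where
  open GraphFacts simple

  Grown : VSet G → Fin (n G) → Set
  Grown R z = z ∈ R ⊎ (z ∈ U × ∃ λ y → y ∈ R × Edge G y z)

  grown? : ∀ R z → Dec (Grown R z)
  grown? R z = z ∈? R ⊎-dec (z ∈? U ×-dec any? λ y → y ∈? R ×-dec Edge? G y z)

  grow : VSet G → VSet G
  grow R = select (grown? R)

  ⊆-grow : ∀ {R} → R ⊆ grow R
  ⊆-grow z∈R = ∈-select⁺ (grown? _) (inj₁ z∈R)

  grow-step : ∀ {R y z} → y ∈ R → z ∈ U → Edge G y z → z ∈ grow R
  grow-step y∈R z∈U yz = ∈-select⁺ (grown? _) (inj₂ (z∈U , _ , y∈R , yz))

  grow-mono : ∀ {R R′} → R ⊆ R′ → grow R ⊆ grow R′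
  grow-mono R⊆R′ z∈ with ∈-select⁻ (grown? _) z∈
  ... | inj₁ z∈R = ⊆-grow (R⊆R′ z∈R)
  ... | inj₂ (z∈U , y , y∈R , yz) = grow-step (R⊆R′ y∈R) z∈U yz

  grow^ : ℕ → VSet G → VSet G
  grow^ zero    R = R
  grow^ (suc k) R = grow (grow^ k R)

  ⊆-grow^ : ∀ k {R} → R ⊆ grow^ k R
  ⊆-grow^ zero    z∈R = z∈R
  ⊆-grow^ (suc k) z∈R = ⊆-grow (⊆-grow^ k z∈R)

  -- each step that is not yet stable adds a vertex
  grow^-stable-or-large : ∀ k R → grow (grow^ k R) ⊆ grow^ k R ⊎ k ≤ ∣ grow^ k R ∣
  grow^-stable-or-large zero    R = inj₂ z≤n
  grow^-stable-or-large (suc k) R with grow (grow^ k R) ⊆? grow^ k R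
  ... | yes stable = inj₁ (grow-mono stable)
  ... | no unstable with grow^-stable-or-large k R
  ...   | inj₁ stable = ⊥-elim (unstable stable)
  ...   | inj₂ k≤ = inj₂ (≤-trans (s≤s k≤) (p⊂q⇒∣p∣<∣q∣ (⊆-grow , ⊈⇒∃∉ unstable)))

  grow^-stable : ∀ R → grow (grow^ (suc (n G)) R) ⊆ grow^ (suc (n G)) R
  grow^-stable R with grow^-stable-or-large (suc (n G)) R
  ... | inj₁ stable = stable
  ... | inj₂ large = contradiction (∣p∣≤n (grow^ (suc (n G)) R)) (<⇒≱ large)

  reachable : Fin (n G) → VSet G
  reachable x = grow^ (suc (n G)) ⁅ x ⁆

  reachable-self : ∀ x → x ∈ reachable x
  reachable-self x = ⊆-grow^ (suc (n G)) (x∈⁅x⁆ x)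

  reachable-closed : ∀ x y z → y ∈ reachable x → z ∈ U → Edge G y z → z ∈ reachable x
  reachable-closed x y z y∈ z∈U yz = grow^-stable ⁅ x ⁆ (grow-step y∈ z∈U yz)

  ∈grow^⇒Reach : ∀ {x} → x ∈ U → ∀ k {z} → z ∈ grow^ k ⁅ x ⁆ → Reach G U x z
  ∈grow^⇒Reach x∈U zero z∈ rewrite x∈⁅y⁆⇒x≡y _ z∈ = here x∈U
  ∈grow^⇒Reach x∈U (suc k) z∈ with ∈-select⁻ (grown? _) z∈
  ... | inj₁ z∈R = ∈grow^⇒Reach x∈U k z∈R
  ... | inj₂ (z∈U , y , y∈R , yz) = step (∈grow^⇒Reach x∈U k y∈R) z∈U yz

  reachable⊆U : ∀ {x} → x ∈ U → reachable x ⊆ U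
  reachable⊆U x∈U = Reach-end ∘ ∈grow^⇒Reach x∈U (suc (n G))

  reachable-connected : ∀ {x} → x ∈ U → Connected G (reachable x)
  reachable-connected {x} x∈U y z y∈ z∈ = Reach-trans (Reach-sym (path y∈)) (path z∈)
    where
    path : ∀ {w} → w ∈ reachable x → Reach G (reachable x) x w
    path = Reach-restrict (reachable-closed x) (reachable-self x) ∘ ∈grow^⇒Reach x∈U (suc (n G))

module _ {G : Graph} (simple : Simple G) (X : VSet G) where
  open Reachability simple (∁ X)

  component : Fin (n G) → VSet G
  component = reachable

  component-isComponent : ∀ {v} → v ∉ X → Component G X (component v)
  component-isComponent {v} v∉X =
    (v , reachable-self v) ,
    (λ z z∈ → x∈∁p⇒x∉p (reachable⊆U (x∉p⇒x∈∁p v∉X) z∈)) ,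
    reachable-connected (x∉p⇒x∈∁p v∉X) ,
    (λ y z y∈ z∉X yz → reachable-closed v y z y∈ (x∉p⇒x∈∁p z∉X) yz)

  ∈component-self : ∀ v → v ∈ component v
  ∈component-self = reachable-self

module ComponentFacts {G : Graph} {X C : VSet G} (comp : Component G X C) where

  rep : Fin (n G)
  rep = let (rep , _) , _ = comp in rep

  rep∈ : rep ∈ C
  rep∈ = let (_ , rep∈) , _ = comp in rep∈

  disjoint : ∀ {x} → x ∈ C → x ∉ X
  disjoint = let _ , disjoint , _ = comp in disjoint _

  connected : Connected G C
  connected = let _ , _ , connected , _ = comp in connected

  closed : ∀ {x y} → x ∈ C → y ∉ X → Edge G x y → y ∈ C
  closed = let _ , _ , _ , closed = comp in closed _ _

  module _ {Y : VSet G} (nb : IsNbhd G C Y) where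

    nbhd⊆ : Y ⊆ X
    nbhd⊆ {y} y∈Y with proj₁ (nb y) y∈Y | y ∈? X
    ... | _ | yes y∈X = y∈X
    ... | y∉C , x , x∈C , xy | no y∉X = contradiction (closed x∈C y∉X xy) y∉C

    neighbour∈ : ∀ {x y} → x ∈ C → y ∈ X → Edge G x y → y ∈ Y
    neighbour∈ x∈C y∈X xy = proj₂ (nb _) ((λ y∈C → disjoint y∈C y∈X) , _ , x∈C , xy)

    X⊈nbhd⇒3≤∣nbhd∣ : Simple G → ThreeConnected G → X ⊈ Y → 3 ≤ ∣ Y ∣
    X⊈nbhd⇒3≤∣nbhd∣ simple tc X⊈Y = ≮⇒≥ λ ∣Y∣<3 →
      let w , w∈X , w∉Y = ⊈⇒∃∉ X⊈Y
          path = proj₂ tc Y ∣Y∣<3 rep w (x∉p⇒x∈∁p rep∉Y) (x∉p⇒x∈∁p w∉Y)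
      in disjoint (GraphFacts.Reach-stays simple closed-in-G-Y rep∈ path) w∈X
      where
      rep∉Y : rep ∉ Y
      rep∉Y rep∈Y = proj₁ (proj₁ (nb rep) rep∈Y) rep∈
      closed-in-G-Y : ∀ x y → x ∈ C → y ∈ ∁ Y → Edge G x y → y ∈ C
      closed-in-G-Y x y x∈C y∈∁Y xy with y ∈? X
      ... | no y∉X = closed x∈C y∉X xy
      ... | yes y∈X = contradiction (neighbour∈ x∈C y∈X xy) (x∈∁p⇒x∉p y∈∁Y)

components-meet⇒⊆ : ∀ {G} → Simple G → ∀ {X C D} → Component G X C → Component G X D →
  ∀ {v} → v ∈ C → v ∈ D → C ⊆ D
components-meet⇒⊆ simple comp-C comp-D v∈C v∈D x∈C =
  GraphFacts.Reach-stays simple (λ _ _ y∈D z∈C yz → D.closed y∈D (C.disjoint z∈C) yz) v∈D (C.connected _ _ v∈C x∈C)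
  where
  module C = ComponentFacts comp-C
  module D = ComponentFacts comp-D

module _ {G : Graph} (simple : Simple G) where
  open GraphFacts simple

  IsSep-Covers : ∀ {A B} → IsSep G A B → Covers G A B B
  IsSep-Covers sep = (λ x → Sum.map₂ inj₁ (proj₁ sep x)) , λ x y xy → Sum.map₂ inj₁ (Edge-inside-side sep xy)

module TangleFacts {G : Graph} (simple : Simple G) {k} {τ : SepSet G} (tangle : Tangle G k τ) where
  open GraphFacts simple

  τ-IsSep : ∀ {A B} → τ A B → IsSep G A B
  τ-IsSep {A} {B} t = proj₁ (proj₁ tangle A B t)

  τ-orients : ∀ {A B} → IsSep G A B → order G A B < k → τ A B ⊎ τ B A
  τ-orients = proj₁ (proj₂ tangle) _ _

  τ-no-cover : ∀ {A₁ B₁ A₂ B₂ A₃ B₃} → τ A₁ B₁ → τ A₂ B₂ → τ A₃ B₃ → ¬ Covers G A₁ A₂ A₃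
  τ-no-cover = proj₂ (proj₂ (proj₂ tangle)) _ _ _ _ _ _

  τ-asym : ∀ {A B} → τ A B → ¬ τ B A
  τ-asym t t′ = τ-no-cover t t′ t′ (IsSep-Covers simple (τ-IsSep t))

  τ-∋-small : ∀ {A B} → IsSep G A B → order G A B < k → (∀ v → v ∈ B) → τ A B
  τ-∋-small sep ord B-full with τ-orients sep ord
  ... | inj₁ t = t
  ... | inj₂ t = contradiction ((λ v → inj₁ (B-full v)) , λ x y _ → inj₁ (B-full x , B-full y)) (τ-no-cover t t t)

  τ-∋-if-big-side-⊇-∩ : ∀ {A₁ B₁ A₂ B₂ A B} → τ A₁ B₁ → τ A₂ B₂ → IsSep G A B → order G A B < k →
    (∀ v → v ∈ B₁ → v ∈ B₂ → v ∈ B) → τ A B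
  τ-∋-if-big-side-⊇-∩ {A₁} {B₁} {A₂} {B₂} {A} {B} t₁ t₂ sep ord ∩⊆B with τ-orients sep ord
  ... | inj₁ t = t
  ... | inj₂ t = contradiction (vertices , edges) (τ-no-cover t₁ t₂ t)
    where
    sep₁ : IsSep G A₁ B₁
    sep₁ = τ-IsSep t₁
    sep₂ : IsSep G A₂ B₂
    sep₂ = τ-IsSep t₂
    vertices : ∀ x → x ∈ A₁ ⊎ x ∈ A₂ ⊎ x ∈ B
    vertices x with proj₁ sep₁ x | proj₁ sep₂ x
    ... | inj₁ x∈A₁ | _         = inj₁ x∈A₁
    ... | inj₂ _    | inj₁ x∈A₂ = inj₂ (inj₁ x∈A₂)
    ... | inj₂ x∈B₁ | inj₂ x∈B₂ = inj₂ (inj₂ (∩⊆B x x∈B₁ x∈B₂))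
    edges : ∀ x y → Edge G x y → Both A₁ x y ⊎ Both A₂ x y ⊎ Both B x y
    edges x y xy with Edge-inside-side sep₁ xy | Edge-inside-side sep₂ xy
    ... | inj₁ in-A₁ | _ = inj₁ in-A₁
    ... | inj₂ _ | inj₁ in-A₂ = inj₂ (inj₁ in-A₂)
    ... | inj₂ (x∈B₁ , y∈B₁) | inj₂ (x∈B₂ , y∈B₂) = inj₂ (inj₂ (∩⊆B x x∈B₁ x∈B₂ , ∩⊆B y y∈B₁ y∈B₂))

Q-Simple : Simple Q
Q-Simple = from-yes (all? λ h → all? λ h′ → QAdj h h′ ≟ᵇ QAdj h′ h) , from-yes (all? λ h → QAdj h h ≟ᵇ false)

Q-vertex : ∀ h → (∃ λ i → h ≡ bQ i) ⊎ (∃ λ i → h ≡ aQ i)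
Q-vertex = from-yes (all? λ h → any? (λ i → h ≟ᶠ bQ i) ⊎-dec any? (λ i → h ≟ᶠ aQ i))

ABEdge : Fin 8 → Fin 8 → Set
ABEdge h h′ = ∃₂ λ i j → i ≢ j × ((h ≡ aQ i × h′ ≡ bQ j) ⊎ (h ≡ bQ j × h′ ≡ aQ i))

Q-edge : ∀ {h h′} → Edge Q h h′ → ABEdge h h′
Q-edge {h} {h′} = from-yes (all? λ h → all? λ h′ → Edge? Q h h′ →-dec any? λ i → any? λ j →
  ¬? (i ≟ᶠ j) ×-dec ((h ≟ᶠ aQ i ×-dec h′ ≟ᶠ bQ j) ⊎-dec (h ≟ᶠ bQ j ×-dec h′ ≟ᶠ aQ i))) h h′

bQ≢aQ : ∀ {i j} → bQ i ≢ aQ j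
bQ≢aQ {i} {j} = from-yes (all? λ i → all? λ j → ¬? (bQ i ≟ᶠ aQ j)) i j

bQ-injective : ∀ {i j} → bQ i ≡ bQ j → i ≡ j
bQ-injective = ↑ˡ-injective 4 _ _

aQ-injective : ∀ {i j} → aQ i ≡ aQ j → i ≡ j
aQ-injective = ↑ʳ-injective 4 _ _

Covered : (G : Graph) → VSet G → Fin (n G) → Set
Covered G A v = ∀ x y → x ∈ A → y ∈ A → Edge G x y → x ≡ v ⊎ y ≡ v

Q-lopsided : ∀ D → 2 ≤ ∣ D ∣ → ∣ nbhd Q D ∣ ≤ 3 → ∣ ∁ (D ∪ nbhd Q D) ∣ ≤ 1
Q-lopsided = from-yes (allSubset? λ D → 2 ≤? ∣ D ∣ →-dec (∣ nbhd Q D ∣ ≤? 3 →-dec ∣ ∁ (D ∪ nbhd Q D) ∣ ≤? 1))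

Q-small-side-star : ∀ A → ∣ A ∣ ≤ 4 → ∣ nbhd Q (∁ A) ∣ ≤ 3 → ∃ (Covered Q A)
Q-small-side-star = from-yes (allSubset? λ A → ∣ A ∣ ≤? 4 →-dec (∣ nbhd Q (∁ A) ∣ ≤? 3 →-dec any? λ v →
  all? λ x → all? λ y → x ∈? A →-dec (y ∈? A →-dec (Edge? Q x y →-dec (x ≟ᶠ v ⊎-dec y ≟ᶠ v)))))

Q-no-vertex-cover-of-size-3 : ∀ u v w → ∃₂ λ x y → Edge Q x y × ¬ (x ≡ u ⊎ y ≡ u) × ¬ (x ≡ v ⊎ y ≡ v) × ¬ (x ≡ w ⊎ y ≡ w)
Q-no-vertex-cover-of-size-3 = from-yes (all? λ u → all? λ v → all? λ w → any? λ x → any? λ y →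
  Edge? Q x y ×-dec ¬? (x ≟ᶠ u ⊎-dec y ≟ᶠ u) ×-dec ¬? (x ≟ᶠ v ⊎-dec y ≟ᶠ v) ×-dec ¬? (x ≟ᶠ w ⊎-dec y ≟ᶠ w))

open GraphFacts Q-Simple using ()
  renaming (Edge-sym to Q-Edge-sym; IsSep-swap to Q-IsSep-swap; Edge-from-private-side to Q-Edge-from-private-side)

cubeTangle : SepSet Q
cubeTangle A B = IsSep Q A B × order Q A B < 4 × ∣ A ─ B ∣ ≤ 1

module _ {A B : Subset 8} (sep : IsSep Q A B) where

  nbhd-private⊆separator : nbhd Q (A ─ B) ⊆ A ∩ B
  nbhd-private⊆separator {y} y∈N with ∈-select⁻ (neighbour? Q (A ─ B)) y∈N
  ... | y∉A─B , x , x∈A─B , xy with y ∈? B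
  ...   | yes y∈B = x∈p∩q⁺ (y∈A , y∈B)
    where y∈A = Q-Edge-from-private-side sep (proj₂ (x∈p─q⁻ _ _ x∈A─B)) xy
  ...   | no  y∉B = contradiction (x∈p∧x∉q⇒x∈p─q y∈A y∉B) y∉A─B
    where y∈A = Q-Edge-from-private-side sep (proj₂ (x∈p─q⁻ _ _ x∈A─B)) xy

  cubeTangle-orients : order Q A B < 4 → cubeTangle A B ⊎ cubeTangle B A
  cubeTangle-orients ord with ∣ A ─ B ∣ ≤? 1
  ... | yes small = inj₁ (sep , ord , small)
  ... | no  large = inj₂ (Q-IsSep-swap sep , subst (_< 4) (cong ∣_∣ (∩-comm A B)) ord ,
                          ≤-trans (p⊆q⇒∣p∣≤∣q∣ B─A⊆rest) (Q-lopsided (A ─ B) (≰⇒> large) ∣N∣≤3))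
    where
    ∣N∣≤3 : ∣ nbhd Q (A ─ B) ∣ ≤ 3
    ∣N∣≤3 = ≤-trans (p⊆q⇒∣p∣≤∣q∣ nbhd-private⊆separator) (≤-pred ord)
    B─A⊆rest : B ─ A ⊆ ∁ ((A ─ B) ∪ nbhd Q (A ─ B))
    B─A⊆rest y∈B─A = x∉p⇒x∈∁p λ y∈ → proj₂ (x∈p─q⁻ _ _ y∈B─A)
      (Sum.[ proj₁ ∘ x∈p─q⁻ _ _ , proj₁ ∘ x∈p∩q⁻ _ _ ∘ nbhd-private⊆separator ] (x∈p∪q⁻ _ _ y∈))

  small-side-star : cubeTangle A B → ∃ (Covered Q A)
  small-side-star (_ , ord , small) = Q-small-side-star A ∣A∣≤4 ∣∂A∣≤3
    where
    ∣A∣≤4 : ∣ A ∣ ≤ 4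
    ∣A∣≤4 = ≤-trans (≤-reflexive (∣p∣≡∣p─q∣+∣p∩q∣ A B)) (+-mono-≤ small (≤-pred ord))
    ∂A⊆separator : nbhd Q (∁ A) ⊆ A ∩ B
    ∂A⊆separator y∈N with ∈-select⁻ (neighbour? Q (∁ A)) y∈N
    ... | y∉∁A , x , x∈∁A , xy =
      x∈p∩q⁺ (x∉∁p⇒x∈p y∉∁A , Q-Edge-from-private-side (Q-IsSep-swap sep) (x∈∁p⇒x∉p x∈∁A) xy)
    ∣∂A∣≤3 : ∣ nbhd Q (∁ A) ∣ ≤ 3
    ∣∂A∣≤3 = ≤-trans (p⊆q⇒∣p∣≤∣q∣ ∂A⊆separator) (≤-pred ord)

cubeTangle-no-cover : ∀ {A₁ B₁ A₂ B₂ A₃ B₃} → cubeTangle A₁ B₁ → cubeTangle A₂ B₂ → cubeTangle A₃ B₃ →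
  ¬ Covers Q A₁ A₂ A₃
cubeTangle-no-cover t₁ t₂ t₃ (_ , edges) =
  let u , covered₁ = small-side-star (proj₁ t₁) t₁
      v , covered₂ = small-side-star (proj₁ t₂) t₂
      w , covered₃ = small-side-star (proj₁ t₃) t₃
      x , y , xy , ¬u , ¬v , ¬w = Q-no-vertex-cover-of-size-3 u v w
  in Sum.[ (λ (x∈ , y∈) → ¬u (covered₁ x y x∈ y∈ xy)) ,
     Sum.[ (λ (x∈ , y∈) → ¬v (covered₂ x y x∈ y∈ xy)) ,
           (λ (x∈ , y∈) → ¬w (covered₃ x y x∈ y∈ xy)) ] ] (edges x y xy)

cubeTangle-Tangle : Tangle Q 4 cubeTangle
cubeTangle-Tangle =
  (λ A B t → proj₁ t , proj₁ (proj₂ t)) ,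
  (λ A B → cubeTangle-orients) ,
  (λ A B t t′ → contradiction (IsSep-Covers Q-Simple (proj₁ t)) (cubeTangle-no-cover t t′ t′)) ,
  (λ _ _ _ _ _ _ → cubeTangle-no-cover)

module _ (i : Fin 4) where

  half₁ half₂ : Subset 8
  half₁ = ⁅ aQ i ⁆ ∪ ⁅ bQ (punchIn i zero) ⁆ ∪ ⁅ bQ (punchIn i (suc zero)) ⁆
  half₂ = ⁅ aQ i ⁆ ∪ ⁅ bQ (punchIn i (suc (suc zero))) ⁆

halves-small : ∀ i → ∣ half₁ i ∣ ≤ 3 × ∣ half₂ i ∣ ≤ 3
halves-small = from-yes (all? λ i → ∣ half₁ i ∣ ≤? 3 ×-dec ∣ half₂ i ∣ ≤? 3)

halves-cover-edges-at-aQ : ∀ i h → Edge Q (aQ i) h → h ∈ half₁ i ⊎ h ∈ half₂ i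
halves-cover-edges-at-aQ = from-yes (all? λ i → all? λ h → Edge? Q (aQ i) h →-dec (h ∈? half₁ i ⊎-dec h ∈? half₂ i))

Q-tangle-small-side-⊉∁⁅aQ⁆ : ∀ {τ} → Tangle Q 4 τ → ∀ i {P R} → τ P R → ¬ (∁ ⁅ aQ i ⁆ ⊆ P)
Q-tangle-small-side-⊉∁⁅aQ⁆ {τ} tangle i {P} t ∁⁅a⁆⊆P =
  τ-no-cover t (half∈τ (proj₁ (halves-small i))) (half∈τ (proj₂ (halves-small i)))
    ((λ h → vertex (h ≟ᶠ aQ i)) , λ h h′ → edge (h ≟ᶠ aQ i) (h′ ≟ᶠ aQ i))
  where
  open TangleFacts Q-Simple tangle
  a∈half₁ : aQ i ∈ half₁ i
  a∈half₁ = x∈p∪q⁺ (inj₁ (x∈⁅x⁆ (aQ i)))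
  a∈half₂ : aQ i ∈ half₂ i
  a∈half₂ = x∈p∪q⁺ (inj₁ (x∈⁅x⁆ (aQ i)))
  half∈τ : ∀ {S} → ∣ S ∣ ≤ 3 → τ S ⊤
  half∈τ {S} ∣S∣≤3 = τ-∋-small ((λ _ → inj₂ ∈⊤) , λ _ _ _ x∉⊤ _ _ → contradiction ∈⊤ x∉⊤)
                   (s≤s (≤-trans (∣p∩q∣≤∣p∣ S ⊤) ∣S∣≤3)) (λ _ → ∈⊤)
  ≢a⇒∈P : ∀ {h} → h ≢ aQ i → h ∈ P
  ≢a⇒∈P h≢a = ∁⁅a⁆⊆P (x∉p⇒x∈∁p (x≢y⇒x∉⁅y⁆ h≢a))
  vertex : ∀ {h} → Dec (h ≡ aQ i) → h ∈ P ⊎ h ∈ half₁ i ⊎ h ∈ half₂ i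
  vertex (yes refl) = inj₂ (inj₁ a∈half₁)
  vertex (no h≢a) = inj₁ (≢a⇒∈P h≢a)
  at-a : ∀ {h} → Edge Q (aQ i) h → Both (half₁ i) (aQ i) h ⊎ Both (half₂ i) (aQ i) h
  at-a ah = Sum.map (a∈half₁ ,_) (a∈half₂ ,_) (halves-cover-edges-at-aQ i _ ah)
  edge : ∀ {h h′} → Dec (h ≡ aQ i) → Dec (h′ ≡ aQ i) → Edge Q h h′ →
    Both P h h′ ⊎ Both (half₁ i) h h′ ⊎ Both (half₂ i) h h′
  edge (yes refl) _ hh′ = inj₂ (at-a hh′)
  edge {h} (no _) (yes refl) hh′ = inj₂ (Sum.map Product.swap Product.swap (at-a (Q-Edge-sym {h} {aQ i} hh′)))
  edge (no h≢a) (no h′≢a) _ = inj₁ (≢a⇒∈P h≢a , ≢a⇒∈P h′≢a)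

module StdCubeMinorFacts {G : Graph} (simple : Simple G) {X : VSet G} {f : Fin (n G) → Maybe (Fin 8)}
                         (std : StdCubeMinor G X f) where
  open GraphFacts simple

  e : Fin 4 → Fin (n G)
  e = let e , _ = std in e

  C : Fin 4 → VSet G
  C = let _ , C , _ = std in C

  e-injective : ∀ i j → e i ≡ e j → i ≡ j
  e-injective = let _ , _ , e-inj , _ = std in e-inj

  e-onto-X : ∀ x → (x ∈ X → ∃ λ i → e i ≡ x) × ((∃ λ i → e i ≡ x) → x ∈ X)
  e-onto-X = let _ , _ , _ , onto , _ = std in onto

  C-component : ∀ i → Component G X (C i) × IsNbhd G (C i) (X - e i)
  C-component = let _ , _ , _ , _ , comp , _ = std in comp

  f-e : ∀ i → f (e i) ≡ just (bQ i)
  f-e = let _ , _ , _ , _ , _ , fe , _ = std in fe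

  f-C : ∀ i {v} → v ∈ C i → f v ≡ just (aQ i)
  f-C i = let _ , _ , _ , _ , _ , _ , fC , _ = std in fC i _

  f-elsewhere : ∀ v → (∀ i → e i ≢ v) → (∀ i → v ∉ C i) → f v ≡ nothing
  f-elsewhere = let _ , _ , _ , _ , _ , _ , _ , f-none = std in f-none

  e∈X : ∀ i → e i ∈ X
  e∈X i = proj₂ (e-onto-X (e i)) (i , refl)

  f-branch : ∀ {v h} → f v ≡ just h → (∃ λ j → h ≡ bQ j × v ≡ e j) ⊎ (∃ λ j → h ≡ aQ j × v ∈ C j)
  f-branch {v} fv with any? (λ j → e j ≟ᶠ v)
  ... | yes (j , refl) = inj₁ (j , just-injective (trans (sym fv) (f-e j)) , refl)
  ... | no ¬e with any? (λ j → v ∈? C j)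
  ...   | yes (j , v∈C) = inj₂ (j , just-injective (trans (sym fv) (f-C j v∈C)) , v∈C)
  ...   | no ¬C with trans (sym fv) (f-elsewhere v (λ i eq → ¬e (i , eq)) (λ i v∈C → ¬C (i , v∈C)))
  ...     | ()

  f-onto : ∀ h → ∃ λ v → f v ≡ just h
  f-onto h with Q-vertex h
  ... | inj₁ (i , refl) = e i , f-e i
  ... | inj₂ (i , refl) = rep , f-C i rep∈
    where open ComponentFacts (proj₁ (C-component i))

  bQ∈image⇒e∈ : ∀ {A j} → bQ j ∈ image f A → e j ∈ A
  bQ∈image⇒e∈ {A} bj∈ with ∈-image⁻ {f = f} {A} bj∈
  ... | v , v∈A , fv with f-branch fv
  ...   | inj₁ (j , eq , refl) = subst (λ j → e j ∈ A) (sym (bQ-injective eq)) v∈A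
  ...   | inj₂ (j , eq , _) = contradiction eq bQ≢aQ

  C-edge-to-e : ∀ {i j} → i ≢ j → ∃ λ x → x ∈ C i × Edge G x (e j)
  C-edge-to-e {i} {j} i≢j = proj₂ (proj₁ (proj₂ (C-component i) (e j))
    (x∈p∧x≢y⇒x∈p-y (e∈X j) λ eq → i≢j (sym (e-injective j i eq))))

  -- such a_i and b_j would come from an edge of G between A ∖ B and B ∖ A
  no-edge-between-private-images : ∀ {A B} → IsSep G A B → ∀ {i j} → i ≢ j →
    aQ i ∈ image f A → aQ i ∉ image f B → bQ j ∈ image f B → bQ j ∉ image f A → ⊥
  no-edge-between-private-images {A} {B} sep i≢j _ ai∉B bj∈B bj∉A =
    let x , x∈C , x-ej = C-edge-to-e i≢j
        x∉B = λ x∈B → ai∉B (∈-image⁺ {f = f} {B} x∈B (f-C _ x∈C))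
    in proj₂ sep x (e _) (∉ʳ⇒∈ˡ sep x∉B) x∉B (bQ∈image⇒e∈ bj∈B)
         (λ ej∈A → bj∉A (∈-image⁺ {f = f} {A} ej∈A (f-e _))) x-ej

  image-IsSep : ∀ {A B} → IsSep G A B → IsSep Q (image f A) (image f B)
  image-IsSep {A} {B} sep = vertices , edges
    where
    vertices : ∀ h → h ∈ image f A ⊎ h ∈ image f B
    vertices h = let v , fv = f-onto h in
      Sum.map (λ v∈A → ∈-image⁺ {f = f} v∈A fv) (λ v∈B → ∈-image⁺ {f = f} v∈B fv) (proj₁ sep v)
    edges : ∀ h h′ → h ∈ image f A → h ∉ image f B → h′ ∈ image f B → h′ ∉ image f A → ¬ Edge Q h h′
    edges h h′ h∈A h∉B h′∈B h′∉A hh′ = by-shape (Q-edge {h} {h′} hh′) h∈A h∉B h′∈B h′∉A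
      where
      by-shape : ∀ {h h′} → ABEdge h h′ →
        h ∈ image f A → h ∉ image f B → h′ ∈ image f B → h′ ∉ image f A → ⊥
      by-shape (i , j , i≢j , inj₁ (refl , refl)) = no-edge-between-private-images sep i≢j
      by-shape (i , j , i≢j , inj₂ (refl , refl)) h∈A h∉B h′∈B h′∉A =
        no-edge-between-private-images (IsSep-swap sep) i≢j h′∈B h′∉A h∈A h∉B

  branch-meets-separator : ∀ {A B} → IsSep G A B → ∀ {v w h} → v ∈ A → f v ≡ just h → w ∈ B → f w ≡ just h →
    ∃ λ u → u ∈ A ∩ B × f u ≡ just h
  branch-meets-separator {A} {B} sep {v} {w} v∈A fv w∈B fw with f-branch fv | f-branch fw
  ... | inj₁ (j , refl , refl) | inj₁ (j′ , eq , refl) =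
    e j , x∈p∩q⁺ (v∈A , subst (λ j → e j ∈ B) (bQ-injective (sym eq)) w∈B) , fv
  ... | inj₁ (_ , refl , _) | inj₂ (_ , eq , _) = contradiction eq bQ≢aQ
  ... | inj₂ (_ , refl , _) | inj₁ (_ , eq , _) = contradiction (sym eq) bQ≢aQ
  ... | inj₂ (j , refl , v∈C) | inj₂ (j′ , eq , w∈C′) with v ∈? B
  ...   | yes v∈B = v , x∈p∩q⁺ (v∈A , v∈B) , fv
  ...   | no v∉B with aQ-injective eq
  ...     | refl with Reach-leaves-through-separator sep (connected _ _ v∈C w∈C′) v∉B
    where open ComponentFacts (proj₁ (C-component j))
  ...       | inj₁ (u , u∈C , u∈A , u∈B) = u , x∈p∩q⁺ (u∈A , u∈B) , f-C j u∈C
  ...       | inj₂ w∉B = contradiction w∈B w∉B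

  image-order≤ : ∀ {A B} → IsSep G A B → order Q (image f A) (image f B) ≤ order G A B
  image-order≤ {A} {B} sep = ∣p∣≤∣q∣-by-injection (image f A ∩ image f B) (A ∩ B)
    (λ h h∈ → proj₁ (meet h∈)) (λ h h∈ → proj₁ (proj₂ (meet h∈)))
    (λ h h′ h∈ h′∈ eq → just-injective (trans (sym (proj₂ (proj₂ (meet h∈))))
                                               (trans (cong f eq) (proj₂ (proj₂ (meet h′∈))))))
    where
    meet : ∀ {h} → h ∈ image f A ∩ image f B → ∃ λ u → u ∈ A ∩ B × f u ≡ just h
    meet h∈ = let h∈A , h∈B = x∈p∩q⁻ _ _ h∈
                  v , v∈A , fv = ∈-image⁻ {f = f} {A} h∈A
                  w , w∈B , fw = ∈-image⁻ {f = f} {B} h∈B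
              in branch-meets-separator sep v∈A fv w∈B fw

  image-Covers : ∀ {A₁ A₂ A₃} → Covers G A₁ A₂ A₃ → Covers Q (image f A₁) (image f A₂) (image f A₃)
  image-Covers {A₁} {A₂} {A₃} (vertices , edges) = vertices′ , edges′
    where
    img : ∀ {A v h} → f v ≡ just h → v ∈ A → h ∈ image f A
    img {A} fv v∈A = ∈-image⁺ {f = f} {A} v∈A fv
    vertices′ : ∀ h → h ∈ image f A₁ ⊎ h ∈ image f A₂ ⊎ h ∈ image f A₃
    vertices′ h = let v , fv = f-onto h in Sum.map (img fv) (Sum.map (img fv) (img fv)) (vertices v)
    lift-edge : ∀ {x y h h′} → f x ≡ just h → f y ≡ just h′ →
      Both A₁ x y ⊎ Both A₂ x y ⊎ Both A₃ x y →
      Both (image f A₁) h h′ ⊎ Both (image f A₂) h h′ ⊎ Both (image f A₃) h h′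
    lift-edge fx fy = Sum.map (Product.map (img fx) (img fy))
                        (Sum.map (Product.map (img fx) (img fy)) (Product.map (img fx) (img fy)))
    edges′ : ∀ h h′ → Edge Q h h′ → Both (image f A₁) h h′ ⊎ Both (image f A₂) h h′ ⊎ Both (image f A₃) h h′
    edges′ h h′ hh′ = by-shape (Q-edge {h} {h′} hh′)
      where
      by-shape : ∀ {h h′} → ABEdge h h′ →
        Both (image f A₁) h h′ ⊎ Both (image f A₂) h h′ ⊎ Both (image f A₃) h h′
      by-shape (i , j , i≢j , inj₁ (refl , refl)) =
        let x , x∈C , x-ej = C-edge-to-e i≢j in lift-edge (f-C i x∈C) (f-e j) (edges x (e j) x-ej)
      by-shape (i , j , i≢j , inj₂ (refl , refl)) =
        let x , x∈C , x-ej = C-edge-to-e i≢j in lift-edge (f-e j) (f-C i x∈C) (edges (e j) x (Edge-sym x-ej))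

module _ {G : Graph} (simple : Simple G) {X : VSet G} {f : Fin (n G) → Maybe (Fin 8)} (std : StdCubeMinor G X f)
         {k} {τ : SepSet Q} (tangle : Tangle Q k τ) where
  open GraphFacts simple
  open StdCubeMinorFacts simple std
  open TangleFacts Q-Simple tangle

  lift : SepSet G
  lift A B = IsSep G A B × order G A B < k × τ (image f A) (image f B)

  lift-Tangle : Tangle G k lift
  lift-Tangle =
    (λ A B t → proj₁ t , proj₁ (proj₂ t)) ,
    (λ A B sep ord → Sum.map (λ t → sep , ord , t)
                             (λ t → IsSep-swap sep , subst (_< k) (cong ∣_∣ (∩-comm A B)) ord , t)
                             (τ-orients (image-IsSep sep) (≤-<-trans (image-order≤ sep) ord))) ,
    (λ A B t t′ → contradiction (proj₂ (proj₂ t′)) (τ-asym (proj₂ (proj₂ t)))) ,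
    (λ _ _ _ _ _ _ t₁ t₂ t₃ → τ-no-cover (proj₂ (proj₂ t₁)) (proj₂ (proj₂ t₂)) (proj₂ (proj₂ t₃)) ∘ image-Covers)

module StarWithBag {G : Graph} (simple : Simple G) {σ : SepSet G} (star : Star G σ) {X : VSet G} (bag : IsBag G σ X) where
  open GraphFacts simple

  σ-IsSep : ∀ {A B} → σ A B → IsSep G A B
  σ-IsSep = proj₁ star _ _

  bag⊆big-side : ∀ {A B} → σ A B → X ⊆ B
  bag⊆big-side {A} {B} s x∈X = proj₁ (bag _) x∈X A B s

  ∈bag⁺ : ∀ {x} → (∀ A B → σ A B → ¬ x ∉ B) → x ∈ X
  ∈bag⁺ {x} never-small = proj₂ (bag x) λ A B s → decidable-stable (x ∈? B) (never-small A B s)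

  separator⊆bag : ∀ {A B} → σ A B → A ∩ B ⊆ X
  separator⊆bag {A} {B} s {z} z∈A∩B = ∈bag⁺ λ C D s′ z∉D → z∉D (z∈D C D s′)
    where
    z∈A : z ∈ A
    z∈A = proj₁ (x∈p∩q⁻ A B z∈A∩B)
    z∈D : ∀ C D → σ C D → z ∈ D
    z∈D C D s′ with A ≟ˢ C | B ≟ˢ D
    ... | yes refl | yes refl = proj₂ (x∈p∩q⁻ A B z∈A∩B)
    ... | no A≢C | _ = proj₁ (proj₂ star A B C D s s′ (λ eq → A≢C (cong proj₁ eq))) z∈A
    ... | _ | no B≢D = proj₁ (proj₂ star A B C D s s′ (λ eq → B≢D (cong proj₂ eq))) z∈A

  Reach-stays-private : ∀ {U A B c z} → (∀ {w} → w ∈ U → w ∉ X) → σ A B → Reach G U c z → c ∉ B → z ∉ B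
  Reach-stays-private U∩X=∅ s path c∉B with Reach-leaves-through-separator (σ-IsSep s) path c∉B
  ... | inj₁ (w , w∈U , w∈A , w∈B) = contradiction (separator⊆bag s (x∈p∩q⁺ (w∈A , w∈B))) (U∩X=∅ w∈U)
  ... | inj₂ z∉B = z∉B

  module _ {C : VSet G} (comp : Component G X C) where
    open ComponentFacts comp

    nbhd⊆separator : ∀ {Y A B c} → IsNbhd G C Y → σ A B → c ∈ C → c ∉ B → Y ⊆ A ∩ B
    nbhd⊆separator nb s c∈C c∉B {y} y∈Y =
      let _ , x , x∈C , xy = proj₁ (nb y) y∈Y
          x∉B = Reach-stays-private disjoint s (connected _ _ c∈C x∈C) c∉B
      in x∈p∩q⁺ (Edge-from-private-side (σ-IsSep s) x∉B xy , bag⊆big-side s (nbhd⊆ nb y∈Y))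

    ∣nbhd∣≤3 : (∀ A B → σ A B → order G A B ≡ 3) → ∀ {Y} → IsNbhd G C Y → ∣ Y ∣ ≤ 3
    ∣nbhd∣≤3 ord3 nb = ≮⇒≥ λ 3<∣Y∣ → disjoint rep∈ (∈bag⁺ λ A B s rep∉B →
      <⇒≱ 3<∣Y∣ (≤-trans (p⊆q⇒∣p∣≤∣q∣ (nbhd⊆separator nb s rep∈ rep∉B)) (≤-reflexive (ord3 A B s))))

module Order3Star {G : Graph} (simple : Simple G) (tc : ThreeConnected G)
  {σ : SepSet G} (star : Star G σ) (ord3 : ∀ A B → σ A B → order G A B ≡ 3)
  {X : VSet G} (bag : IsBag G σ X) (x4 : ∣ X ∣ ≡ 4) where
  open GraphFacts simple
  open StarWithBag simple star bag

  ∣X-x∣≡3 : ∀ {x} → x ∈ X → ∣ X - x ∣ ≡ 3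
  ∣X-x∣≡3 x∈X = suc-injective (trans (sym (∣p∣≡1+∣p-x∣ x∈X)) x4)

  X⊈small : ∀ {Y} → ∣ Y ∣ ≤ 3 → X ⊈ Y
  X⊈small ∣Y∣≤3 X⊆Y = <⇒≱ (≤-trans (≤-reflexive (sym x4)) (p⊆q⇒∣p∣≤∣q∣ X⊆Y)) ∣Y∣≤3

  nbhd-3-subset : ∀ {C Y} → Component G X C → IsNbhd G C Y → Y ⊆ X × ∣ Y ∣ ≡ 3
  nbhd-3-subset {Y = Y} comp nb = nbhd⊆ nb , ≤-antisym ∣Y∣≤3 (X⊈nbhd⇒3≤∣nbhd∣ nb simple tc (X⊈small ∣Y∣≤3))
    where
    open ComponentFacts comp
    ∣Y∣≤3 : ∣ Y ∣ ≤ 3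
    ∣Y∣≤3 = ∣nbhd∣≤3 comp ord3 nb

  module FromTangle {τ : SepSet G} (tangle : Tangle G 4 τ) (σ⊆τ : ∀ A B → σ A B → τ A B) where
    open TangleFacts simple tangle

    record Detached (x : Fin (n G)) (T : VSet G) : Set where
      field
        outside-bag : ∀ {v} → v ∈ T → v ∉ X
        closed      : ∀ {v z} → v ∈ T → z ∉ X → Edge G v z → z ∈ T
        avoids      : ∀ {v} → v ∈ T → ¬ Edge G v x

    module _ {x T} (x∈X : x ∈ X) (det : Detached x T) where
      open Detached det

      cut-IsSep : IsSep G ((X - x) ∪ T) (∁ T)
      cut-IsSep = vertices , edges
        where
        vertices : ∀ v → v ∈ (X - x) ∪ T ⊎ v ∈ ∁ T
        vertices v with v ∈? T
        ... | yes v∈T = inj₁ (x∈p∪q⁺ (inj₂ v∈T))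
        ... | no  v∉T = inj₂ (x∉p⇒x∈∁p v∉T)
        edges : ∀ v z → v ∈ (X - x) ∪ T → v ∉ ∁ T → z ∈ ∁ T → z ∉ (X - x) ∪ T → ¬ Edge G v z
        edges v z _ v∉∁T z∈∁T z∉left vz with v ∈? T | z ∈? X
        ... | no v∉T | _ = v∉∁T (x∉p⇒x∈∁p v∉T)
        ... | yes v∈T | no z∉X = x∈∁p⇒x∉p z∈∁T (closed v∈T z∉X vz)
        ... | yes v∈T | yes z∈X =
          z∉left (x∈p∪q⁺ (inj₁ (x∈p∧x≢y⇒x∈p-y z∈X λ { refl → avoids v∈T vz })))

      cut-order : order G ((X - x) ∪ T) (∁ T) < 4
      cut-order = s≤s (≤-trans (p⊆q⇒∣p∣≤∣q∣ separator⊆X-x) (≤-reflexive (∣X-x∣≡3 x∈X)))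
        where
        separator⊆X-x : ((X - x) ∪ T) ∩ ∁ T ⊆ X - x
        separator⊆X-x v∈ with x∈p∩q⁻ _ _ v∈
        ... | v∈left , v∈∁T = Sum.[ (λ v∈X-x → v∈X-x) , (λ v∈T → contradiction v∈T (x∈∁p⇒x∉p v∈∁T)) ]
                                 (x∈p∪q⁻ _ _ v∈left)

      -- a connected T lies on the private side of some element of σ ⊆ τ, so τ cannot point towards T
      τ-∋-cut : ∀ {u} → Connected G T → u ∈ T → τ ((X - x) ∪ T) (∁ T)
      τ-∋-cut {u} conn u∈T with τ-orients cut-IsSep cut-order
      ... | inj₁ t = t
      ... | inj₂ t = contradiction (∈bag⁺ λ A B s u∉B → τ-no-cover t (σ⊆τ A B s) (σ⊆τ A B s) (covering s u∉B))
                                   (outside-bag u∈T)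
        where
        covering : ∀ {A B} → σ A B → u ∉ B → Covers G (∁ T) A A
        covering s u∉B = vertices , edges
          where
          T-private : ∀ {v} → v ∈ T → v ∉ _
          T-private v∈T = Reach-stays-private outside-bag s (conn _ _ u∈T v∈T) u∉B
          vertices : ∀ v → v ∈ ∁ T ⊎ v ∈ _ ⊎ v ∈ _
          vertices v with v ∈? T
          ... | yes v∈T = inj₂ (inj₁ (∉ʳ⇒∈ˡ (σ-IsSep s) (T-private v∈T)))
          ... | no  v∉T = inj₁ (x∉p⇒x∈∁p v∉T)
          edges : ∀ v z → Edge G v z → Both (∁ T) v z ⊎ Both _ v z ⊎ Both _ v z
          edges v z vz with v ∈? T | z ∈? T
          ... | yes v∈T | _ = inj₂ (inj₁ (∉ʳ⇒∈ˡ (σ-IsSep s) (T-private v∈T) ,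
                                           Edge-from-private-side (σ-IsSep s) (T-private v∈T) vz))
          ... | no _ | yes z∈T = inj₂ (inj₁ (Edge-from-private-side (σ-IsSep s) (T-private z∈T) (Edge-sym vz) ,
                                              ∉ʳ⇒∈ˡ (σ-IsSep s) (T-private z∈T)))
          ... | no v∉T | no z∉T = inj₁ (x∉p⇒x∈∁p v∉T , x∉p⇒x∈∁p z∉T)

    Detached-⋃ : ∀ {x m} (S : Fin m → VSet G) → (∀ u → Detached x (S u)) → Detached x (⋃ (List.tabulate S))
    Detached-⋃ S det = record
      { outside-bag = λ v∈ → let u , v∈Su = ∈⋃-tabulate⁻ S v∈ in Detached.outside-bag (det u) v∈Su
      ; closed      = λ v∈ z∉X vz → let u , v∈Su = ∈⋃-tabulate⁻ S v∈ in
                                    ∈⋃-tabulate⁺ S u (Detached.closed (det u) v∈Su z∉X vz)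
      ; avoids      = λ v∈ → let u , v∈Su = ∈⋃-tabulate⁻ S v∈ in Detached.avoids (det u) v∈Su
      }

    τ-∋-cut-⋃ : ∀ {x} → x ∈ X → ∀ {m} (S : Fin m → VSet G) (det : ∀ u → Detached x (S u)) →
      (∀ u → τ ((X - x) ∪ S u) (∁ (S u))) → τ ((X - x) ∪ ⋃ (List.tabulate S)) (∁ (⋃ (List.tabulate S)))
    τ-∋-cut-⋃ x∈X {zero} S det _ =
      τ-∋-small (cut-IsSep x∈X (Detached-⋃ S det)) (cut-order x∈X (Detached-⋃ S det)) (λ _ → x∉p⇒x∈∁p ∉∅)
    τ-∋-cut-⋃ x∈X {suc m} S det t =
      τ-∋-if-big-side-⊇-∩ (t zero) (τ-∋-cut-⋃ x∈X (S ∘ suc) (det ∘ suc) (t ∘ suc))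
        (cut-IsSep x∈X (Detached-⋃ S det)) (cut-order x∈X (Detached-⋃ S det))
        λ v v∉S₀ v∉rest → x∉p⇒x∈∁p λ v∈ → Sum.[ x∈∁p⇒x∉p v∉S₀ , x∈∁p⇒x∉p v∉rest ] (x∈p∪q⁻ _ _ v∈)

    Far : Fin (n G) → Fin (n G) → Set
    Far x u = u ∉ X × x ∉ nbhd G (component simple X u)

    far? : ∀ x u → Dec (Far x u)
    far? x u = ¬? (u ∈? X) ×-dec ¬? (x ∈? nbhd G (component simple X u))

    piece : ∀ {x u} → Dec (Far x u) → VSet G
    piece {u = u} (yes _) = component simple X u
    piece         (no  _) = ∅

    far : Fin (n G) → VSet G
    far x = ⋃ (List.tabulate λ u → piece (far? x u))

    module _ {x} (x∈X : x ∈ X) where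

      piece-Detached : ∀ {u} (d : Dec (Far x u)) → Detached x (piece d)
      piece-Detached {u} (yes (u∉X , x∉N)) = record
        { outside-bag = disjoint
        ; closed      = closed
        ; avoids      = λ v∈ vx → x∉N (neighbour∈ (nbhd-IsNbhd G _) v∈ x∈X vx)
        }
        where open ComponentFacts (component-isComponent simple X u∉X)
      piece-Detached (no _) = record { outside-bag = λ v∈ → contradiction v∈ ∉∅
                                     ; closed = λ v∈ → contradiction v∈ ∉∅
                                     ; avoids = λ v∈ → contradiction v∈ ∉∅ }

      τ-∋-cut-piece : ∀ {u} (d : Dec (Far x u)) → τ ((X - x) ∪ piece d) (∁ (piece d))
      τ-∋-cut-piece {u} d@(yes (u∉X , _)) = τ-∋-cut x∈X (piece-Detached d) connected rep∈
        where open ComponentFacts (component-isComponent simple X u∉X)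
      τ-∋-cut-piece d@(no _) =
        τ-∋-small (cut-IsSep x∈X (piece-Detached d)) (cut-order x∈X (piece-Detached d)) (λ _ → x∉p⇒x∈∁p ∉∅)

      τ-∋-cut-far : τ ((X - x) ∪ far x) (∁ (far x))
      τ-∋-cut-far = τ-∋-cut-⋃ x∈X _ (λ u → piece-Detached (far? x u)) (λ u → τ-∋-cut-piece (far? x u))

    component⊆far : ∀ {x u} → Far x u → component simple X u ⊆ far x
    component⊆far {x} {u} f {v} v∈ = ∈⋃-tabulate⁺ _ u (∈piece (far? x u))
      where
      ∈piece : (d : Dec (Far x u)) → v ∈ piece d
      ∈piece (yes _) = v∈
      ∈piece (no ¬f) = contradiction f ¬f

    module NoComponentWithNbhd {Y : VSet G} (Y⊆X : Y ⊆ X) (∣Y∣≡3 : ∣ Y ∣ ≡ 3)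
      (no-component : ∀ {v} → v ∉ X → nbhd G (component simple X v) ≢ Y) where

      N : Fin (n G) → VSet G
      N v = nbhd G (component simple X v)

      N-3-subset : ∀ {v} → v ∉ X → N v ⊆ X × ∣ N v ∣ ≡ 3
      N-3-subset v∉X = nbhd-3-subset (component-isComponent simple X v∉X) (nbhd-IsNbhd G _)

      X⊈Y : X ⊈ Y
      X⊈Y = X⊈small (≤-reflexive ∣Y∣≡3)

      x : Fin (n G)
      x = proj₁ (⊈⇒∃∉ X⊈Y)
      x∈X : x ∈ X
      x∈X = proj₁ (proj₂ (⊈⇒∃∉ X⊈Y))
      x∉Y : x ∉ Y
      x∉Y = proj₂ (proj₂ (⊈⇒∃∉ X⊈Y))

      ⊆X-x : ∀ {Z} → Z ⊆ X → x ∉ Z → Z ⊆ X - x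
      ⊆X-x Z⊆X x∉Z z∈Z = x∈p∧x≢y⇒x∈p-y (Z⊆X z∈Z) λ z≡x → x∉Z (subst (_∈ _) z≡x z∈Z)

      -- otherwise N v ⊆ X - x ⊆ Y, and all three have three elements
      x∈N : ∀ {v} → v ∉ X → x ∈ N v
      x∈N {v} v∉X with x ∈? N v
      ... | yes x∈N = x∈N
      ... | no  x∉N = contradiction (⊆-antisym N⊆Y Y⊆N) (no-component v∉X)
        where
        X-x⊆Y : X - x ⊆ Y
        X-x⊆Y = ⊆∧∣q∣≤∣p∣⇒q⊆p (⊆X-x Y⊆X x∉Y) (≤-reflexive (trans (∣X-x∣≡3 x∈X) (sym ∣Y∣≡3)))
        N⊆Y : N v ⊆ Y
        N⊆Y z∈N = X-x⊆Y (⊆X-x (proj₁ (N-3-subset v∉X)) x∉N z∈N)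
        Y⊆N : Y ⊆ N v
        Y⊆N = ⊆∧∣q∣≤∣p∣⇒q⊆p N⊆Y (≤-reflexive (trans ∣Y∣≡3 (sym (proj₂ (N-3-subset v∉X)))))

      open Enumeration (subst (Enumeration X) x4 (enumeration X))

      i₀ : Fin 4
      i₀ = proj₁ (at-surjective x∈X)
      at-i₀ : at i₀ ≡ x
      at-i₀ = proj₂ (at-surjective x∈X)

      missing : ∀ {v} → v ∉ X → ∃ λ j → at j ∉ N v
      missing {v} v∉X = ¬∀⟶∃¬ 4 _ (λ j → at j ∈? N v) λ all∈N →
        X⊈small (≤-reflexive (proj₂ (N-3-subset v∉X)))
          λ z∈X → let a , at-a = at-surjective z∈X in subst (_∈ N v) at-a (all∈N a)

      miss : ∀ {v} → v ∉ X → Fin 4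
      miss v∉X = proj₁ (missing v∉X)

      miss≢i₀ : ∀ {v} (v∉X : v ∉ X) → miss v∉X ≢ i₀
      miss≢i₀ v∉X miss≡i₀ = proj₂ (missing v∉X) (subst (_∈ N _) (sym (trans (cong at miss≡i₀) at-i₀)) (x∈N v∉X))

      side : Fin 4 → VSet G
      side j = (X - at j) ∪ far (at j)

      self∈side : ∀ {v} (v∉X : v ∉ X) → v ∈ side (miss v∉X)
      self∈side {v} v∉X =
        x∈p∪q⁺ (inj₂ (component⊆far (v∉X , proj₂ (missing v∉X)) (∈component-self simple X v)))

      nbr∈side : ∀ {v z} (v∉X : v ∉ X) → Edge G v z → z ∈ side (miss v∉X)
      nbr∈side {v} {z} v∉X vz = by-cases (z ∈? X)
        where
        open ComponentFacts (component-isComponent simple X v∉X)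
        v∈ : v ∈ component simple X v
        v∈ = ∈component-self simple X v
        by-cases : Dec (z ∈ X) → z ∈ side (miss v∉X)
        by-cases (no z∉X) = x∈p∪q⁺ (inj₂ (component⊆far (v∉X , proj₂ (missing v∉X)) (closed v∈ z∉X vz)))
        by-cases (yes z∈X) = x∈p∪q⁺ (inj₁ (x∈p∧x≢y⇒x∈p-y z∈X λ z≡at →
          proj₂ (missing v∉X) (subst (_∈ N v) z≡at (neighbour∈ (nbhd-IsNbhd G _) v∈ z∈X vz))))

      ∈side : ∀ {z a j} → at a ≡ z → j ≢ a → z ∈ side j
      ∈side {a = a} refl j≢a = x∈p∪q⁺ (inj₁ (x∈p∧x≢y⇒x∈p-y (at-∈ a) λ eq → j≢a (at-injective _ _ (sym eq))))

      Side₀ Side₁ Side₂ : VSet G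
      Side₀ = side (punchIn i₀ zero)
      Side₁ = side (punchIn i₀ (suc zero))
      Side₂ = side (punchIn i₀ (suc (suc zero)))

      vertex-covered : ∀ {v} → Dec (v ∈ X) → v ∈ Side₀ ⊎ v ∈ Side₁ ⊎ v ∈ Side₂
      vertex-covered (no v∉X) = one-of-three-others (λ j → _ ∈ side j) i₀ (miss≢i₀ v∉X) (self∈side v∉X)
      vertex-covered (yes v∈X) =
        let a , at-a = at-surjective v∈X
            j , j≢i₀ , j≢a , _ = ∃-Fin4-avoiding i₀ a a
        in one-of-three-others (λ j → _ ∈ side j) i₀ j≢i₀ (∈side at-a j≢a)

      edge-covered : ∀ {v z} → Edge G v z → Dec (v ∈ X) → Dec (z ∈ X) →
        Both Side₀ v z ⊎ Both Side₁ v z ⊎ Both Side₂ v z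
      edge-covered vz (no v∉X) _ =
        one-of-three-others (λ j → Both (side j) _ _) i₀ (miss≢i₀ v∉X) (self∈side v∉X , nbr∈side v∉X vz)
      edge-covered vz (yes _) (no z∉X) =
        Sum.map Product.swap (Sum.map Product.swap Product.swap)
          (one-of-three-others (λ j → Both (side j) _ _) i₀ (miss≢i₀ z∉X)
            (self∈side z∉X , nbr∈side z∉X (Edge-sym vz)))
      edge-covered vz (yes v∈X) (yes z∈X) =
        let a , at-a = at-surjective v∈X
            b , at-b = at-surjective z∈X
            j , j≢i₀ , j≢a , j≢b = ∃-Fin4-avoiding i₀ a b
        in one-of-three-others (λ j → Both (side j) _ _) i₀ j≢i₀ (∈side at-a j≢a , ∈side at-b j≢b)

      absurd : ⊥
      absurd = τ-no-cover (τ-∋-cut-far (at-∈ _)) (τ-∋-cut-far (at-∈ _)) (τ-∋-cut-far (at-∈ _))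
                 ((λ v → vertex-covered (v ∈? X)) , λ v z vz → edge-covered vz (v ∈? X) (z ∈? X))

    3-subset-is-nbhd : ∀ Y → Y ⊆ X → ∣ Y ∣ ≡ 3 → ∃ λ C → Component G X C × IsNbhd G C Y
    3-subset-is-nbhd Y Y⊆X ∣Y∣≡3 with any? (λ v → ¬? (v ∈? X) ×-dec (nbhd G (component simple X v) ≟ˢ Y))
    ... | yes (v , v∉X , N≡Y) =
      component simple X v , component-isComponent simple X v∉X , subst (IsNbhd G _) N≡Y (nbhd-IsNbhd G _)
    ... | no none = ⊥-elim (NoComponentWithNbhd.absurd Y⊆X ∣Y∣≡3 λ v∉X N≡Y → none (_ , v∉X , N≡Y))

  tangle⇒cubic : (Σ (SepSet G) λ τ → Tangle G 4 τ × (∀ A B → σ A B → τ A B)) → Cubic G X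
  tangle⇒cubic (τ , tangle , σ⊆τ) = x4 , (λ C Y → nbhd-3-subset) , FromTangle.3-subset-is-nbhd tangle σ⊆τ

  σ-order<4 : ∀ {A B} → σ A B → order G A B < 4
  σ-order<4 s = subst (_< 4) (sym (ord3 _ _ s)) (n<1+n 3)

  cubic⇒lift-includes : ∀ f → StdCubeMinor G X f → ∀ τQ → Tangle Q 4 τQ → LiftIncludes G f 4 τQ σ
  cubic⇒lift-includes f std τQ tangle A B s =
    σ-order<4 s , oriented (τ-orients (image-IsSep (σ-IsSep s)) (≤-<-trans (image-order≤ (σ-IsSep s)) (σ-order<4 s)))
    where
    open StdCubeMinorFacts simple std
    open TangleFacts Q-Simple tangle
    e∉separator : ∃ λ i → e i ∉ A ∩ B
    e∉separator = ¬∀⟶∃¬ 4 _ (λ i → e i ∈? A ∩ B) λ all∈ →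
      X⊈small (≤-reflexive (ord3 A B s)) λ x∈X → let j , ej = proj₁ (e-onto-X _) x∈X in subst (_∈ A ∩ B) ej (all∈ j)
    i : Fin 4
    i = proj₁ e∉separator
    by-vertex : ∀ {h} → (∃ λ j → h ≡ bQ j) ⊎ (∃ λ j → h ≡ aQ j) → h ≢ aQ i → h ∈ image f B
    by-vertex (inj₁ (j , refl)) _ = ∈-image⁺ {f = f} {B} (bag⊆big-side s (e∈X j)) (f-e j)
    by-vertex (inj₂ (j , refl)) aj≢ai = rep-side (rep ∈? B)
      where
      open ComponentFacts (proj₁ (C-component j))
      ei∈X-ej : e i ∈ X - e j
      ei∈X-ej = x∈p∧x≢y⇒x∈p-y (e∈X i) λ ei≡ej → aj≢ai (cong aQ (e-injective j i (sym ei≡ej)))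
      rep-side : Dec (rep ∈ B) → aQ j ∈ image f B
      rep-side (yes rep∈B) = ∈-image⁺ {f = f} {B} rep∈B (f-C j rep∈)
      rep-side (no rep∉B) = contradiction
        (nbhd⊆separator (proj₁ (C-component j)) (proj₂ (C-component j)) s rep∈ rep∉B ei∈X-ej) (proj₂ e∉separator)
    ∁⁅ai⁆⊆big-side : ∁ ⁅ aQ i ⁆ ⊆ image f B
    ∁⁅ai⁆⊆big-side {h} h∈ = by-vertex (Q-vertex h) (x∉⁅y⁆⇒x≢y (x∈∁p⇒x∉p h∈))
    oriented : τQ (image f A) (image f B) ⊎ τQ (image f B) (image f A) → τQ (image f A) (image f B)
    oriented (inj₁ t) = t
    oriented (inj₂ t) = ⊥-elim (Q-tangle-small-side-⊉∁⁅aQ⁆ tangle i t ∁⁅ai⁆⊆big-side)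

  module StandardCubeMinor (cubic : Cubic G X) where
    open Enumeration (subst (Enumeration X) x4 (enumeration X))

    C-exists : ∀ i → ∃ λ C → Component G X C × IsNbhd G C (X - at i)
    C-exists i = proj₂ (proj₂ cubic) (X - at i) (p─q⊆p X _) (∣X-x∣≡3 (at-∈ i))

    C : Fin 4 → VSet G
    C i = proj₁ (C-exists i)

    C-disjoint : ∀ {i j v} → v ∈ C i → v ∈ C j → i ≡ j
    C-disjoint {i} {j} v∈Ci v∈Cj with i ≟ᶠ j
    ... | yes i≡j = i≡j
    ... | no  i≢j =
      let Ci-comp , Ci-nbhd = proj₂ (C-exists i)
          Cj-comp , Cj-nbhd = proj₂ (C-exists j)
          _ , x , x∈Ci , x-atj = proj₁ (Ci-nbhd (at j)) (x∈p∧x≢y⇒x∈p-y (at-∈ j) λ eq → i≢j (at-injective i j (sym eq)))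
          x∈Cj = components-meet⇒⊆ simple Ci-comp Cj-comp v∈Ci v∈Cj x∈Ci
          atj∈X-atj = ComponentFacts.neighbour∈ Cj-comp Cj-nbhd x∈Cj (at-∈ j) x-atj
      in contradiction (x∈⁅x⁆ (at j)) (proj₂ (x∈p─q⁻ X _ atj∈X-atj))

    classify : ∀ {v} → Dec (∃ λ j → at j ≡ v) → Dec (∃ λ j → v ∈ C j) → Maybe (Fin 8)
    classify (yes (j , _)) _            = just (bQ j)
    classify (no _)        (yes (j , _)) = just (aQ j)
    classify (no _)        (no _)        = nothing

    φ : Fin (n G) → Maybe (Fin 8)
    φ v = classify (any? λ j → at j ≟ᶠ v) (any? λ j → v ∈? C j)

    φ-at : ∀ i → φ (at i) ≡ just (bQ i)
    φ-at i = by-cases _ _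
      where
      by-cases : ∀ d d′ → classify {at i} d d′ ≡ just (bQ i)
      by-cases (yes (j , eq)) _ = cong (just ∘ bQ) (at-injective j i eq)
      by-cases (no ¬at) _ = contradiction (i , refl) ¬at

    φ-C : ∀ i v → v ∈ C i → φ v ≡ just (aQ i)
    φ-C i v v∈C = by-cases _ _
      where
      by-cases : ∀ d d′ → classify {v} d d′ ≡ just (aQ i)
      by-cases (yes (j , refl)) _ = contradiction (at-∈ j) (ComponentFacts.disjoint (proj₁ (proj₂ (C-exists i))) v∈C)
      by-cases (no _) (yes (j , v∈Cj)) = cong (just ∘ aQ) (C-disjoint v∈Cj v∈C)
      by-cases (no _) (no ¬C) = contradiction (i , v∈C) ¬C

    φ-elsewhere : ∀ v → (∀ i → at i ≢ v) → (∀ i → v ∉ C i) → φ v ≡ nothing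
    φ-elsewhere v ¬at ¬C = by-cases _ _
      where
      by-cases : ∀ d d′ → classify {v} d d′ ≡ nothing
      by-cases (yes (j , eq)) _ = contradiction eq (¬at j)
      by-cases (no _) (yes (j , v∈C)) = contradiction v∈C (¬C j)
      by-cases (no _) (no _) = refl

    std : StdCubeMinor G X φ
    std = at , C , at-injective , (λ x → at-surjective , λ (i , eq) → subst (_∈ X) eq (at-∈ i)) ,
          (proj₂ ∘ C-exists) , φ-at , φ-C , φ-elsewhere

  lift-includes⇒tangle :
    (Cubic G X × (∀ f → StdCubeMinor G X f → ∀ τQ → Tangle Q 4 τQ → LiftIncludes G f 4 τQ σ)) →
    Σ (SepSet G) λ τ → Tangle G 4 τ × (∀ A B → σ A B → τ A B)
  lift-includes⇒tangle (cubic , includes) =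
    lift simple std cubeTangle-Tangle , lift-Tangle simple std cubeTangle-Tangle ,
    λ A B s → σ-IsSep s , includes φ std cubeTangle cubeTangle-Tangle A B s
    where open StandardCubeMinor cubic

proposition2p6 : (G : Graph) → Simple G → ThreeConnected G →
    (σ : SepSet G) → Star G σ → (∀ A B → σ A B → order G A B ≡ 3) →
    (X : VSet G) → IsBag G σ X → ∣ X ∣ ≡ 4 →
    ((Σ (SepSet G) λ τ → Tangle G 4 τ × (∀ A B → σ A B → τ A B)) → Cubic G X) ×
    (Cubic G X → Cubic G X × (∀ (f : Fin (n G) → Maybe (Fin 8)) → StdCubeMinor G X f →
        ∀ (τQ : SepSet Q) → Tangle Q 4 τQ → LiftIncludes G f 4 τQ σ)) ×
    ((Cubic G X × (∀ (f : Fin (n G) → Maybe (Fin 8)) → StdCubeMinor G X f →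
        ∀ (τQ : SepSet Q) → Tangle Q 4 τQ → LiftIncludes G f 4 τQ σ)) →
      Σ (SepSet G) λ τ → Tangle G 4 τ × (∀ A B → σ A B → τ A B))
proposition2p6 G simple tc σ star ord3 X bag x4 =
  tangle⇒cubic , (λ cubic → cubic , cubic⇒lift-includes) , lift-includes⇒tangle
  where open Order3Star simple tc star ord3 bag x4
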